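{- The meet semantics is strictly finer than failures semantics: $\sqsubseteq_{R\lor FT}\subseteq\sqsubseteq_F$ and $\sqsubseteq_F\not\subseteq\sqsubseteq_{R\lor FT}$.
   Context: BCCSP processes over a set $\mathit{Act}$: $p ::= \mathbf{0}\mid ap\mid p+q$; transitions $ap\xrightarrow{a}p$, and $p\xrightarrow{a}p'$ implies $p+q\xrightarrow{a}p'$ and $q+p\xrightarrow{a}p'$; $p\overset{\alpha}{\Rightarrow}q$ for sequences. $I(p)=\{a\mid\exists p'.\,p\xrightarrow{a}p'\}$. $p\sqsubseteq_F q$ iff $\{(\alpha,X)\mid\exists p'.\,p\overset{\alpha}{\Rightarrow}p',\ I(p')\cap X=\emptyset\}$ is included in the same set for $q$. Derivability $E\vdash t\preceq u$ uses reflexivity, transitivity, closure under prefixing and $+$, and closed substitution instances of axioms (conditional axioms only under closed substitutions satisfying the condition). Axioms: $(B_1)$ $x+y\simeq y+x$; $(B_2)$ $(x+y)+z\simeq x+(y+z)$; $(B_3)$ $x+x\simeq x$; $(B_4)$ $x+\mathbf{0}\simeq x$ (each $\simeq$ meaning both inequations); $(RS)$ $I(x)=I(y)\Rightarrow x\preceq x+y$; $(ND^R)$ $I(x)\supseteq I(y)\Rightarrow a(x+y)\preceq ax+a(y+w)$ (each $a$); $(ND^{FT})$ $I(w)\subseteq I(y)\Rightarrow a(x+y)\preceq ax+a(y+w)$ (each $a$). $p\sqsubseteq_{R\lor FT}q$ iff $\{B_1\text{ -- }B_4,(RS),(ND^R),(ND^{FT})\}\vdash p\preceq q$. -}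

module Defs where

open import Data.List using (List; []; _∷_)
open import Data.Product using (Σ; _×_; _,_)
open import Data.Empty using (⊥)

data Proc (Act : Set) : Set where
  𝟎   : Proc Act
  _∙_ : Act → Proc Act → Proc Act
  _⊕_ : Proc Act → Proc Act → Proc Act

infixr 7 _∙_
infixl 6 _⊕_

module _ {Act : Set} where

  data _—[_]→_ : Proc Act → Act → Proc Act → Set where
    pre  : ∀ {a p} → (a ∙ p) —[ a ]→ p
    sumL : ∀ {p q a p'} → p —[ a ]→ p' → (p ⊕ q) —[ a ]→ p'
    sumR : ∀ {p q a p'} → p —[ a ]→ p' → (q ⊕ p) —[ a ]→ p'

  data _=[_]⇒_ : Proc Act → List Act → Proc Act → Set where
    done : ∀ {p} → p =[ [] ]⇒ p
    step : ∀ {p a p' α p''} → p —[ a ]→ p' → p' =[ α ]⇒ p'' → p =[ a ∷ α ]⇒ p''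

  I : Proc Act → Act → Set
  I p a = Σ (Proc Act) (λ p' → p —[ a ]→ p')

  _⊆I_ : Proc Act → Proc Act → Set
  p ⊆I q = ∀ a → I p a → I q a

  _≐I_ : Proc Act → Proc Act → Set
  p ≐I q = (p ⊆I q) × (q ⊆I p)

  Failure : Proc Act → List Act → (Act → Set) → Set
  Failure p α X = Σ (Proc Act) (λ p' → p =[ α ]⇒ p' × (∀ a → I p' a → X a → ⊥))

  _⊑F_ : Proc Act → Proc Act → Set₁
  p ⊑F q = ∀ α (X : Act → Set) → Failure p α X → Failure q α X

  -- derivability from {B1–B4, RS, ND^R, ND^FT}, over closed terms
  -- (closed substitution instances of the axioms; conditional axioms
  --  only when the closed instance satisfies the condition)
  data _⊑RFT_ : Proc Act → Proc Act → Set where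
    refl'  : ∀ {p} → p ⊑RFT p
    trans' : ∀ {p q r} → p ⊑RFT q → q ⊑RFT r → p ⊑RFT r
    pref   : ∀ {a p q} → p ⊑RFT q → (a ∙ p) ⊑RFT (a ∙ q)
    plus   : ∀ {p p' q q'} → p ⊑RFT p' → q ⊑RFT q' → (p ⊕ q) ⊑RFT (p' ⊕ q')
    B1     : ∀ {x y} → (x ⊕ y) ⊑RFT (y ⊕ x)
    B2     : ∀ {x y z} → ((x ⊕ y) ⊕ z) ⊑RFT (x ⊕ (y ⊕ z))
    B2'    : ∀ {x y z} → (x ⊕ (y ⊕ z)) ⊑RFT ((x ⊕ y) ⊕ z)
    B3     : ∀ {x} → (x ⊕ x) ⊑RFT x
    B3'    : ∀ {x} → x ⊑RFT (x ⊕ x)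
    B4     : ∀ {x} → (x ⊕ 𝟎) ⊑RFT x
    B4'    : ∀ {x} → x ⊑RFT (x ⊕ 𝟎)
    RS     : ∀ {x y} → x ≐I y → x ⊑RFT (x ⊕ y)
    NDR    : ∀ {a x y w} → y ⊆I x → (a ∙ (x ⊕ y)) ⊑RFT ((a ∙ x) ⊕ (a ∙ (y ⊕ w)))
    NDFT   : ∀ {a x y w} → w ⊆I y → (a ∙ (x ⊕ y)) ⊑RFT ((a ∙ x) ⊕ (a ∙ (y ⊕ w)))

-- Every axiom of R∨FT preserves, besides failure pairs (α, X), the ready pairs
-- (α, {c}) with a singleton ready set: the root side condition of ND^FT is
-- exactly what keeps a state with initials {c} on the right-hand side.  Hence
-- ⊑RFT is included in failures.  Conversely a·a·0 and a·0 + a·(a·0 + b·0) have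
-- the same failures, but only the former reaches, after a, a state offering
-- exactly {a}; so the two cannot be related by ⊑RFT.
module Submission where

open import Data.Empty using (⊥)
open import Data.List using (List; []; _∷_)
open import Data.Product using (Σ; _×_; _,_; proj₁; proj₂)
open import Data.Sum using (_⊎_; inj₁; inj₂; [_,_]′)
import Data.Sum as Sum
open import Function using (id; _∘_)
open import Relation.Binary.Definitions using (_Respects_)
open import Relation.Binary.PropositionalEquality using (_≢_; refl; sym)
open import Relation.Nullary using (¬_)

open import Defs

module _ {Act : Set} where

  private
    variable
      a c : Act
      α : List Act
      p p' q q' r x y w : Proc Act
      X : Act → Set

  I-⊕ : I (p ⊕ q) a → I p a ⊎ I q a
  I-⊕ (p' , sumL t) = inj₁ (p' , t)
  I-⊕ (p' , sumR t) = inj₂ (p' , t)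

  ⊆I-⊕ : p ⊆I r → q ⊆I r → (p ⊕ q) ⊆I r
  ⊆I-⊕ p⊆r q⊆r a = [ p⊆r a , q⊆r a ]′ ∘ I-⊕

  ∙-⊆I : (a ∙ p) ⊆I (a ∙ q)
  ∙-⊆I _ (_ , pre) = _ , pre

  _⊆→_ : Proc Act → Proc Act → Set
  p ⊆→ q = ∀ {a p'} → p —[ a ]→ p' → q —[ a ]→ p'

  ⊆→⇒⊆I : p ⊆→ q → p ⊆I q
  ⊆→⇒⊆I p⊆q _ (p' , t) = p' , p⊆q t

  ⊕-comm-⊆→ : (p ⊕ q) ⊆→ (q ⊕ p)
  ⊕-comm-⊆→ (sumL t) = sumR t
  ⊕-comm-⊆→ (sumR t) = sumL t

  ⊕-assoc-⊆→ : ((p ⊕ q) ⊕ r) ⊆→ (p ⊕ (q ⊕ r))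
  ⊕-assoc-⊆→ (sumL (sumL t)) = sumL t
  ⊕-assoc-⊆→ (sumL (sumR t)) = sumR (sumL t)
  ⊕-assoc-⊆→ (sumR t)        = sumR (sumR t)

  ⊕-assoc⁻¹-⊆→ : (p ⊕ (q ⊕ r)) ⊆→ ((p ⊕ q) ⊕ r)
  ⊕-assoc⁻¹-⊆→ (sumL t)        = sumL (sumL t)
  ⊕-assoc⁻¹-⊆→ (sumR (sumL t)) = sumL (sumR t)
  ⊕-assoc⁻¹-⊆→ (sumR (sumR t)) = sumR t

  ⊕-idem-⊆→ : (p ⊕ p) ⊆→ p
  ⊕-idem-⊆→ (sumL t) = t
  ⊕-idem-⊆→ (sumR t) = t

  ⊕-identityʳ-⊆→ : (p ⊕ 𝟎) ⊆→ p
  ⊕-identityʳ-⊆→ (sumL t) = t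

  Refuses : (Act → Set) → Proc Act → Set
  Refuses X s = ∀ a → I s a → X a → ⊥

  OffersOnly : Act → Proc Act → Set
  OffersOnly c s = I s c × Refuses (_≢ c) s

  Refuses-antitone : q ⊆I p → Refuses X p → Refuses X q
  Refuses-antitone q⊆p refuses a = refuses a ∘ q⊆p a

  Refuses-respects : ∀ X → Refuses X Respects _≐I_
  Refuses-respects X = Refuses-antitone ∘ proj₂

  OffersOnly-respects : ∀ c → OffersOnly c Respects _≐I_
  OffersOnly-respects c (p⊆q , q⊆p) (i , refuses) = p⊆q c i , Refuses-antitone q⊆p refuses

  Refuses-⊕ : Refuses X p → Refuses X q → Refuses X (p ⊕ q)
  Refuses-⊕ refuses-p refuses-q a i = [ refuses-p a , refuses-q a ]′ (I-⊕ i)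

  Refuses-⊕ˡ : Refuses X (p ⊕ q) → Refuses X p
  Refuses-⊕ˡ = Refuses-antitone (⊆→⇒⊆I sumL)

  Refuses-⊕ʳ : Refuses X (p ⊕ q) → Refuses X q
  Refuses-⊕ʳ = Refuses-antitone (⊆→⇒⊆I sumR)

  OffersOnly-⊕ : OffersOnly c (p ⊕ q) → OffersOnly c p ⊎ OffersOnly c q
  OffersOnly-⊕ (i , refuses) =
    Sum.map (_, Refuses-⊕ˡ refuses) (_, Refuses-⊕ʳ refuses) (I-⊕ i)

  Reaches : (Proc Act → Set) → Proc Act → List Act → Set
  Reaches P p α = Σ (Proc Act) λ p' → p =[ α ]⇒ p' × P p'

  -- Inclusion of P-observations; p ⊑F q is this for all P = Refuses X.
  _⊑⟨_⟩_ : Proc Act → (Proc Act → Set) → Proc Act → Set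
  p ⊑⟨ P ⟩ q = ∀ α → Reaches P p α → Reaches P q α

  module _ {P : Proc Act → Set} where

    ⊑⟨⟩-root : p ⊑⟨ P ⟩ q → P p → P q
    ⊑⟨⟩-root {p = p} p⊑q Pp with p⊑q [] (p , done , Pp)
    ... | _ , done , Pq = Pq

    ⊑⟨⟩-intro : (P p → P q) → (∀ a α → Reaches P p (a ∷ α) → Reaches P q (a ∷ α)) →
                p ⊑⟨ P ⟩ q
    ⊑⟨⟩-intro root _    []      (_ , done , Pp) = _ , done , root Pp
    ⊑⟨⟩-intro _    next (a ∷ α) reach           = next a α reach

    Reaches-⊆→ : p ⊆→ q → Reaches P p (a ∷ α) → Reaches P q (a ∷ α)
    Reaches-⊆→ p⊆q (r , step t s , Pr) = r , step (p⊆q t) s , Pr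

    Reaches-⊕ : Reaches P (p ⊕ q) (a ∷ α) → Reaches P p (a ∷ α) ⊎ Reaches P q (a ∷ α)
    Reaches-⊕ (r , step (sumL t) s , Pr) = inj₁ (r , step t s , Pr)
    Reaches-⊕ (r , step (sumR t) s , Pr) = inj₂ (r , step t s , Pr)

    ⊑⟨⟩-⊕ : (P (p ⊕ q) → P (p' ⊕ q')) → p ⊑⟨ P ⟩ p' → q ⊑⟨ P ⟩ q' →
            (p ⊕ q) ⊑⟨ P ⟩ (p' ⊕ q')
    ⊑⟨⟩-⊕ root p⊑p' q⊑q' = ⊑⟨⟩-intro root λ _ _ →
      [ Reaches-⊆→ sumL ∘ p⊑p' _ , Reaches-⊆→ sumR ∘ q⊑q' _ ]′ ∘ Reaches-⊕

  module Laws {P : Proc Act → Set} (resp : P Respects _≐I_) where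

    ⊑⟨⟩-∙ : p ⊑⟨ P ⟩ q → (a ∙ p) ⊑⟨ P ⟩ (a ∙ q)
    ⊑⟨⟩-∙ p⊑q = ⊑⟨⟩-intro (resp (∙-⊆I , ∙-⊆I)) λ where
      _ α (r , step pre s , Pr) → let r' , s' , Pr' = p⊑q α (r , s , Pr)
                                  in r' , step pre s' , Pr'

    ⊑⟨⟩-⊆→ : q ⊆I p → p ⊆→ q → p ⊑⟨ P ⟩ q
    ⊑⟨⟩-⊆→ q⊆p p⊆q = ⊑⟨⟩-intro (resp (⊆→⇒⊆I p⊆q , q⊆p)) λ _ _ → Reaches-⊆→ p⊆q

    ⊑⟨⟩-ND : (P (x ⊕ y) → P x ⊎ P (y ⊕ w)) →
             (a ∙ (x ⊕ y)) ⊑⟨ P ⟩ ((a ∙ x) ⊕ (a ∙ (y ⊕ w)))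
    ⊑⟨⟩-ND {x = x} {y} {w} {a} root = ⊑⟨⟩-intro (resp (lhs⊆rhs , rhs⊆lhs)) next
      where
      lhs⊆rhs : (a ∙ (x ⊕ y)) ⊆I ((a ∙ x) ⊕ (a ∙ (y ⊕ w)))
      lhs⊆rhs _ (_ , pre) = _ , sumL pre
      rhs⊆lhs : ((a ∙ x) ⊕ (a ∙ (y ⊕ w))) ⊆I (a ∙ (x ⊕ y))
      rhs⊆lhs = ⊆I-⊕ ∙-⊆I ∙-⊆I
      next : ∀ b α → Reaches P (a ∙ (x ⊕ y)) (b ∷ α) →
             Reaches P ((a ∙ x) ⊕ (a ∙ (y ⊕ w))) (b ∷ α)
      next _ _ (_ , step pre done , Pxy) with root Pxy
      ... | inj₁ Px  = x , step (sumL pre) done , Px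
      ... | inj₂ Pyw = y ⊕ w , step (sumR pre) done , Pyw
      next _ _ (r , step pre (step (sumL t) s) , Pr) = r , step (sumL pre) (step t s) , Pr
      next _ _ (r , step pre (step (sumR t) s) , Pr) =
        r , step (sumR pre) (step (sumL t) s) , Pr

  _⊑FO_ : Proc Act → Proc Act → Set₁
  p ⊑FO q = (∀ X → p ⊑⟨ Refuses X ⟩ q) × (∀ c → p ⊑⟨ OffersOnly c ⟩ q)

  ⊑FO-uniform : (∀ {P} → P Respects _≐I_ → p ⊑⟨ P ⟩ q) → p ⊑FO q
  ⊑FO-uniform law = (λ X → law (Refuses-respects X)) , (λ c → law (OffersOnly-respects c))

  ⊑FO-trans : p ⊑FO q → q ⊑FO r → p ⊑FO r
  ⊑FO-trans (Fpq , Opq) (Fqr , Oqr) =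
    (λ X α → Fqr X α ∘ Fpq X α) , (λ c α → Oqr c α ∘ Opq c α)

  ⊑FO-∙ : p ⊑FO q → (a ∙ p) ⊑FO (a ∙ q)
  ⊑FO-∙ (F , O) =
    (λ X → Laws.⊑⟨⟩-∙ (Refuses-respects X) (F X)) ,
    (λ c → Laws.⊑⟨⟩-∙ (OffersOnly-respects c) (O c))

  ⊑FO-⊕ : p ⊑FO p' → q ⊑FO q' → (p ⊕ q) ⊑FO (p' ⊕ q')
  ⊑FO-⊕ {p = p} {p'} {q} {q'} (Fp , Op) (Fq , Oq) =
    (λ X → ⊑⟨⟩-⊕ (refuses-root X) (Fp X) (Fq X)) ,
    (λ c → ⊑⟨⟩-⊕ (offersOnly-root c) (Op c) (Oq c))
    where
    refuses-root : ∀ X → Refuses X (p ⊕ q) → Refuses X (p' ⊕ q')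
    refuses-root X refuses =
      Refuses-⊕ (⊑⟨⟩-root (Fp X) (Refuses-⊕ˡ refuses)) (⊑⟨⟩-root (Fq X) (Refuses-⊕ʳ refuses))
    -- Uses the refusal component; this is why both observations are proved together.
    offersOnly-root : ∀ c → OffersOnly c (p ⊕ q) → OffersOnly c (p' ⊕ q')
    offersOnly-root c only =
      [ ⊆→⇒⊆I sumL c ∘ proj₁ ∘ ⊑⟨⟩-root (Op c) , ⊆→⇒⊆I sumR c ∘ proj₁ ∘ ⊑⟨⟩-root (Oq c) ]′
        (OffersOnly-⊕ only) ,
      refuses-root _ (proj₂ only)

  ⊑FO-NDR : y ⊆I x → (a ∙ (x ⊕ y)) ⊑FO ((a ∙ x) ⊕ (a ∙ (y ⊕ w)))
  ⊑FO-NDR y⊆x = ⊑FO-uniform λ resp →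
    Laws.⊑⟨⟩-ND resp (inj₁ ∘ resp (⊆I-⊕ (λ _ → id) y⊆x , ⊆→⇒⊆I sumL))

  ⊑FO-NDFT : w ⊆I y → (a ∙ (x ⊕ y)) ⊑FO ((a ∙ x) ⊕ (a ∙ (y ⊕ w)))
  ⊑FO-NDFT {w = w} {y} {x = x} w⊆y =
    (λ X → Laws.⊑⟨⟩-ND (Refuses-respects X) (inj₂ ∘ Refuses-antitone yw⊆xy)) ,
    (λ c → Laws.⊑⟨⟩-ND (OffersOnly-respects c) (offersOnly-root c))
    where
    yw⊆xy : (y ⊕ w) ⊆I (x ⊕ y)
    yw⊆xy = ⊆I-⊕ (⊆→⇒⊆I sumR) (λ a → ⊆→⇒⊆I sumR a ∘ w⊆y a)
    offersOnly-root : ∀ c → OffersOnly c (x ⊕ y) → OffersOnly c x ⊎ OffersOnly c (y ⊕ w)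
    offersOnly-root c (i , refuses) with I-⊕ i
    ... | inj₁ ix = inj₁ (ix , Refuses-⊕ˡ refuses)
    ... | inj₂ iy = inj₂ (⊆→⇒⊆I sumL c iy , Refuses-antitone yw⊆xy refuses)

  ⊑RFT⇒⊑FO : p ⊑RFT q → p ⊑FO q
  ⊑RFT⇒⊑FO refl'         = ⊑FO-uniform λ _ _ → id
  ⊑RFT⇒⊑FO (trans' d e)  = ⊑FO-trans (⊑RFT⇒⊑FO d) (⊑RFT⇒⊑FO e)
  ⊑RFT⇒⊑FO (pref d)      = ⊑FO-∙ (⊑RFT⇒⊑FO d)
  ⊑RFT⇒⊑FO (plus d e)    = ⊑FO-⊕ (⊑RFT⇒⊑FO d) (⊑RFT⇒⊑FO e)
  ⊑RFT⇒⊑FO B1            = ⊑FO-uniform λ resp →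
    Laws.⊑⟨⟩-⊆→ resp (⊆→⇒⊆I ⊕-comm-⊆→) ⊕-comm-⊆→
  ⊑RFT⇒⊑FO B2            = ⊑FO-uniform λ resp →
    Laws.⊑⟨⟩-⊆→ resp (⊆→⇒⊆I ⊕-assoc⁻¹-⊆→) ⊕-assoc-⊆→
  ⊑RFT⇒⊑FO B2'           = ⊑FO-uniform λ resp →
    Laws.⊑⟨⟩-⊆→ resp (⊆→⇒⊆I ⊕-assoc-⊆→) ⊕-assoc⁻¹-⊆→
  ⊑RFT⇒⊑FO B3            = ⊑FO-uniform λ resp →
    Laws.⊑⟨⟩-⊆→ resp (⊆→⇒⊆I sumL) ⊕-idem-⊆→
  ⊑RFT⇒⊑FO B3'           = ⊑FO-uniform λ resp →
    Laws.⊑⟨⟩-⊆→ resp (⊆→⇒⊆I ⊕-idem-⊆→) sumL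
  ⊑RFT⇒⊑FO B4            = ⊑FO-uniform λ resp →
    Laws.⊑⟨⟩-⊆→ resp (⊆→⇒⊆I sumL) ⊕-identityʳ-⊆→
  ⊑RFT⇒⊑FO B4'           = ⊑FO-uniform λ resp →
    Laws.⊑⟨⟩-⊆→ resp (⊆→⇒⊆I ⊕-identityʳ-⊆→) sumL
  ⊑RFT⇒⊑FO (RS (_ , y⊆x)) = ⊑FO-uniform λ resp →
    Laws.⊑⟨⟩-⊆→ resp (⊆I-⊕ (λ _ → id) y⊆x) sumL
  ⊑RFT⇒⊑FO (NDR y⊆x)     = ⊑FO-NDR y⊆x
  ⊑RFT⇒⊑FO (NDFT w⊆y)    = ⊑FO-NDFT w⊆y

  ⊑RFT⇒⊑F : p ⊑RFT q → p ⊑F q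
  ⊑RFT⇒⊑F d α X = proj₁ (⊑RFT⇒⊑FO d) X α

module Counterexample {Act : Set} (a b : Act) (a≢b : a ≢ b) where

  p q : Proc Act
  p = a ∙ a ∙ 𝟎
  q = a ∙ 𝟎 ⊕ a ∙ (a ∙ 𝟎 ⊕ b ∙ 𝟎)

  p⊑Fq : p ⊑F q
  p⊑Fq []          X (_ , done , refuses) =
    q , done , Refuses-antitone (⊆I-⊕ ∙-⊆I ∙-⊆I) refuses
  p⊑Fq (_ ∷ [])     X (_ , step pre done , _)            = 𝟎 , step (sumL pre) done , λ _ ()
  p⊑Fq (_ ∷ _ ∷ []) X (_ , step pre (step pre done) , _) =
    𝟎 , step (sumR pre) (step (sumL pre) done) , λ _ ()
  p⊑Fq (_ ∷ _ ∷ _ ∷ _) X (_ , step pre (step pre (step () _)) , _)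

  p⋢FOq : ¬ (p ⊑FO q)
  p⋢FOq (_ , O) = q-offers-not-only-a (O a (a ∷ []) (a ∙ 𝟎 , step pre done , a∙𝟎-offers-only-a))
    where
    a∙𝟎-offers-only-a : OffersOnly a (a ∙ 𝟎)
    a∙𝟎-offers-only-a = (𝟎 , pre) , λ { _ (_ , pre) c≢a → c≢a refl }
    q-offers-not-only-a : ¬ Reaches (OffersOnly a) q (a ∷ [])
    q-offers-not-only-a (_ , step (sumL pre) done , ((_ , ()) , _))
    q-offers-not-only-a (_ , step (sumR pre) done , (_ , refuses)) =
      refuses b (_ , sumR pre) (a≢b ∘ sym)

proposition8p10 : (Act : Set) (a b : Act) → a ≢ b →
    ((p q : Proc Act) → p ⊑RFT q → p ⊑F q)
      × ¬ ((p q : Proc Act) → p ⊑F q → p ⊑RFT q)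
proposition8p10 Act a b a≢b =
  (λ _ _ → ⊑RFT⇒⊑F) ,
  (λ ⊑F⊆⊑RFT → p⋢FOq (⊑RFT⇒⊑FO (⊑F⊆⊑RFT p q p⊑Fq)))
  where open Counterexample a b a≢b
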